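{- Let $k,\ell$ be positive odd integers with $\ell>k$. For all integers $n \geq 2$ and all positive divisors $d \mid n$, we have $a_{k,\ell}(n,d) < 0$ if and only if $d = n$.
   Context: For positive integers $n$ and $d\mid n$, define \[ a_{k,\ell}(n,d) := (n^{3\ell} + n^{2\ell} + n^{\ell} + 1)\, d^{3k} - (n^{3k} + n^{2k} + n^{k} + 1)\, d^{3\ell}. \] -}

module Defs where

open import Data.Nat as ℕ using (ℕ)
open import Data.Nat.Divisibility using (_∣_)
open import Data.Integer using (ℤ; +_; _+_; _-_; _*_; _^_)
open import Relation.Nullary using (¬_)

Odd : ℕ → Set
Odd n = ¬ (2 ∣ n)

a : ℕ → ℕ → ℕ → ℕ → ℤ
a k ℓ n d =
  ((+ n) ^ (3 ℕ.* ℓ) + (+ n) ^ (2 ℕ.* ℓ) + (+ n) ^ ℓ + + 1) * (+ d) ^ (3 ℕ.* k)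
  - ((+ n) ^ (3 ℕ.* k) + (+ n) ^ (2 ℕ.* k) + (+ n) ^ k + + 1) * (+ d) ^ (3 ℕ.* ℓ)

module Submission where

-- Put P(x) = x³ + x² + x + 1, so that a_{k,ℓ}(n,d) = P(nˡ)(dᵏ)³ − P(nᵏ)(dˡ)³.
-- For d = n and x = nᵏ < y = nˡ this is negative because P(y)/y³ = 1 + 1/y + 1/y² + 1/y³
-- is strictly decreasing.  For a proper divisor, 2d ≤ n; writing ℓ = k + m, x = nᵏ,
-- e = dᵏ, D = dᵐ and M = nᵐ ≥ 2D we get
--   P(x)(eD)³ ≤ 4x³e³D³ ≤ x³e³(2D)³ ≤ (xM)³e³ ≤ P(xM)e³,
-- so a ≥ 0.

open import Defs
open import Data.Nat using (ℕ; zero; suc; _+_; _*_; _^_; _<_; _≤_; z<s; >-nonZero)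
open import Data.Nat.Properties
open import Data.Nat.Divisibility using (_∣_; quotient; quotient>1; m∣n⇒n≡quotient*m; ∣⇒≤)
open import Data.Nat.Tactic.RingSolver using (solve-∀)
open import Data.Integer as ℤ using (ℤ)
import Data.Integer.Properties as ℤₚ
open import Data.Product using (_×_; _,_)
open import Data.Sum using (inj₁; inj₂)
open import Relation.Binary.PropositionalEquality
  using (_≡_; refl; sym; trans; cong; cong₂; subst; module ≡-Reasoning)
open import Relation.Nullary using (contradiction)

cube : ℕ → ℕ
cube x = x * x * x

P : ℕ → ℕ
P x = cube x + x * x + x + 1

x<y⇒P[y]*x³<P[x]*y³ : ∀ {x y} → x < y → P y * cube x < P x * cube y
x<y⇒P[y]*x³<P[x]*y³ {x} {y} x<y = begin-strict
    P y * cube x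
  ≡⟨ expandˡ x y ⟩
    cube y * cube x + (x * x * y * y) * x + (x * y) * (x * x) + cube x
  <⟨ +-mono-≤-< (+-mono-≤ (+-mono-≤ (≤-reflexive (*-comm (cube y) (cube x)))
                                    (*-monoʳ-≤ (x * x * y * y) x≤y))
                          (*-monoʳ-≤ (x * y) (*-mono-≤ x≤y x≤y)))
                (*-mono-< (*-mono-< x<y x<y) x<y) ⟩
    cube x * cube y + (x * x * y * y) * y + (x * y) * (y * y) + cube y
  ≡⟨ expandʳ x y ⟨
    P x * cube y ∎
  where
    open ≤-Reasoning
    x≤y : x ≤ y
    x≤y = <⇒≤ x<y
    expandˡ : ∀ x y → (y * y * y + y * y + y + 1) * (x * x * x)
            ≡ y * y * y * (x * x * x) + (x * x * y * y) * x + (x * y) * (x * x) + x * x * x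
    expandˡ = solve-∀
    expandʳ : ∀ x y → (x * x * x + x * x + x + 1) * (y * y * y)
            ≡ x * x * x * (y * y * y) + (x * x * y * y) * y + (x * y) * (y * y) + y * y * y
    expandʳ = solve-∀

x³≤P[x] : ∀ x → cube x ≤ P x
x³≤P[x] x = ≤-trans (m≤m+n (cube x) (x * x)) (≤-trans (m≤m+n _ x) (m≤m+n _ 1))

P[x]≤4*x³ : ∀ {x} → 1 ≤ x → P x ≤ 4 * cube x
P[x]≤4*x³ {x} 1≤x = begin
    cube x + x * x + x + 1
  ≡⟨ pad x ⟩
    cube x + x * x * 1 + x * (1 * 1) + 1 * 1 * 1
  ≤⟨ +-mono-≤ (+-mono-≤ (+-monoʳ-≤ (cube x) (*-monoʳ-≤ (x * x) 1≤x))
                        (*-monoʳ-≤ x (*-mono-≤ 1≤x 1≤x)))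
              (*-mono-≤ (*-mono-≤ 1≤x 1≤x) 1≤x) ⟩
    cube x + x * x * x + x * (x * x) + cube x
  ≡⟨ collect x ⟩
    4 * cube x ∎
  where
    open ≤-Reasoning
    pad : ∀ x → x * x * x + x * x + x + 1 ≡ x * x * x + x * x * 1 + x * (1 * 1) + 1 * 1 * 1
    pad = solve-∀
    collect : ∀ x → x * x * x + x * x * x + x * (x * x) + x * x * x ≡ 4 * (x * x * x)
    collect = solve-∀

P[x]*[e*D]³≤P[x*M]*e³ : ∀ {x M} e D → 1 ≤ x → 2 * D ≤ M → P x * cube (e * D) ≤ P (x * M) * cube e
P[x]*[e*D]³≤P[x*M]*e³ {x} {M} e D 1≤x 2D≤M = begin
    P x * cube (e * D)
  ≤⟨ *-monoˡ-≤ (cube (e * D)) (P[x]≤4*x³ 1≤x) ⟩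
    4 * cube x * cube (e * D)
  ≡⟨ regroup x e D ⟩
    cube x * cube e * (4 * cube D)
  ≤⟨ *-monoʳ-≤ (cube x * cube e) (m≤n*m (4 * cube D) 2) ⟩
    cube x * cube e * (2 * (4 * cube D))
  ≡⟨ cong (cube x * cube e *_) (cube-double D) ⟩
    cube x * cube e * cube (2 * D)
  ≤⟨ *-monoʳ-≤ (cube x * cube e) (*-mono-≤ (*-mono-≤ 2D≤M 2D≤M) 2D≤M) ⟩
    cube x * cube e * cube M
  ≡⟨ regroup′ x e M ⟩
    cube (x * M) * cube e
  ≤⟨ *-monoˡ-≤ (cube e) (x³≤P[x] (x * M)) ⟩
    P (x * M) * cube e ∎
  where
    open ≤-Reasoning
    regroup : ∀ x e D → 4 * (x * x * x) * ((e * D) * (e * D) * (e * D))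
            ≡ x * x * x * (e * e * e) * (4 * (D * D * D))
    regroup = solve-∀
    cube-double : ∀ D → 2 * (4 * (D * D * D)) ≡ (2 * D) * (2 * D) * (2 * D)
    cube-double = solve-∀
    regroup′ : ∀ x e M → x * x * x * (e * e * e) * (M * M * M)
             ≡ (x * M) * (x * M) * (x * M) * (e * e * e)
    regroup′ = solve-∀

2*d≤n⇒2*d^[1+i]≤n^[1+i] : ∀ {d n} i → 2 * d ≤ n → 2 * d ^ suc i ≤ n ^ suc i
2*d≤n⇒2*d^[1+i]≤n^[1+i] {d} {n} i 2d≤n = begin
    2 * (d * d ^ i) ≡⟨ *-assoc 2 d (d ^ i) ⟨
    2 * d * d ^ i   ≤⟨ *-mono-≤ 2d≤n (^-monoˡ-≤ i (≤-trans (m≤n*m d 2) 2d≤n)) ⟩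
    n * n ^ i       ∎
  where open ≤-Reasoning

P[nᵏ]*[dˡ]³≤P[nˡ]*[dᵏ]³ : ∀ {k ℓ n d} → 1 ≤ n → 2 * d ≤ n → k < ℓ →
                          P (n ^ k) * cube (d ^ ℓ) ≤ P (n ^ ℓ) * cube (d ^ k)
P[nᵏ]*[dˡ]³≤P[nˡ]*[dᵏ]³ {k} {_} {n} {d} 1≤n 2d≤n k<ℓ with m≤n⇒∃[o]m+o≡n k<ℓ
... | j , refl = begin
    P (n ^ k) * cube (d ^ suc (k + j))    ≡⟨ cong (λ t → P (n ^ k) * cube t) (split d) ⟩
    P (n ^ k) * cube (d ^ k * d ^ suc j)  ≤⟨ P[x]*[e*D]³≤P[x*M]*e³ (d ^ k) (d ^ suc j) 1≤nᵏ 2dʲ⁺¹≤nʲ⁺¹ ⟩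
    P (n ^ k * n ^ suc j) * cube (d ^ k)  ≡⟨ cong (λ t → P t * cube (d ^ k)) (split n) ⟨
    P (n ^ suc (k + j)) * cube (d ^ k)    ∎
  where
    open ≤-Reasoning
    1≤nᵏ : 1 ≤ n ^ k
    1≤nᵏ = m^n>0 n {{>-nonZero 1≤n}} k
    2dʲ⁺¹≤nʲ⁺¹ : 2 * d ^ suc j ≤ n ^ suc j
    2dʲ⁺¹≤nʲ⁺¹ = 2*d≤n⇒2*d^[1+i]≤n^[1+i] {d} j 2d≤n
    split : ∀ x → x ^ suc (k + j) ≡ x ^ k * x ^ suc j
    split x = trans (cong (x ^_) (sym (+-suc k j))) (^-distribˡ-+-* x k (suc j))

m∣n∧m<n⇒2*m≤n : ∀ {m n} → m ∣ n → m < n → 2 * m ≤ n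
m∣n∧m<n⇒2*m≤n {m} {n} m∣n m<n = begin
    2 * m            ≤⟨ *-monoˡ-≤ m (quotient>1 m∣n m<n) ⟩
    quotient m∣n * m ≡⟨ m∣n⇒n≡quotient*m m∣n ⟨
    n                ∎
  where open ≤-Reasoning

n^[j*i]≡[n^i]^j : ∀ n i j → n ^ (j * i) ≡ (n ^ i) ^ j
n^[j*i]≡[n^i]^j n i j = trans (cong (n ^_) (*-comm j i)) (sym (^-*-assoc n i j))

n^[3*i]≡[n^i]³ : ∀ n i → n ^ (3 * i) ≡ cube (n ^ i)
n^[3*i]≡[n^i]³ n i = trans (n^[j*i]≡[n^i]^j n i 3) (unfold (n ^ i))
  where
    unfold : ∀ x → x * (x * (x * 1)) ≡ x * x * x
    unfold = solve-∀

n^[3*i]+n^[2*i]+n^i+1≡P[n^i] : ∀ n i → n ^ (3 * i) + n ^ (2 * i) + n ^ i + 1 ≡ P (n ^ i)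
n^[3*i]+n^[2*i]+n^i+1≡P[n^i] n i = cong₂ (λ u v → u + v + n ^ i + 1) (n^[3*i]≡[n^i]³ n i) n^[2*i]≡
  where
    n^[2*i]≡ : n ^ (2 * i) ≡ n ^ i * n ^ i
    n^[2*i]≡ = trans (n^[j*i]≡[n^i]^j n i 2) (cong (n ^ i *_) (*-identityʳ (n ^ i)))

pos-^ : ∀ m i → ℤ.+ (m ^ i) ≡ (ℤ.+ m) ℤ.^ i
pos-^ m zero    = refl
pos-^ m (suc i) = trans (ℤₚ.pos-* m (m ^ i)) (cong ((ℤ.+ m) ℤ.*_) (pos-^ m i))

pos-n^p+n^q+n^r+1 : ∀ n p q r → ℤ.+ (n ^ p + n ^ q + n ^ r + 1)
                  ≡ (ℤ.+ n) ℤ.^ p ℤ.+ (ℤ.+ n) ℤ.^ q ℤ.+ (ℤ.+ n) ℤ.^ r ℤ.+ ℤ.+ 1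
pos-n^p+n^q+n^r+1 n p q r = begin
    ℤ.+ (n ^ p + n ^ q + n ^ r + 1)
  ≡⟨ ℤₚ.pos-+ (n ^ p + n ^ q + n ^ r) 1 ⟩
    ℤ.+ (n ^ p + n ^ q + n ^ r) ℤ.+ ℤ.+ 1
  ≡⟨ cong (ℤ._+ ℤ.+ 1) (ℤₚ.pos-+ (n ^ p + n ^ q) (n ^ r)) ⟩
    ℤ.+ (n ^ p + n ^ q) ℤ.+ ℤ.+ (n ^ r) ℤ.+ ℤ.+ 1
  ≡⟨ cong (λ t → t ℤ.+ ℤ.+ (n ^ r) ℤ.+ ℤ.+ 1) (ℤₚ.pos-+ (n ^ p) (n ^ q)) ⟩
    ℤ.+ (n ^ p) ℤ.+ ℤ.+ (n ^ q) ℤ.+ ℤ.+ (n ^ r) ℤ.+ ℤ.+ 1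
  ≡⟨ cong₂ (λ u v → u ℤ.+ v ℤ.+ ℤ.+ 1) (cong₂ ℤ._+_ (pos-^ n p) (pos-^ n q)) (pos-^ n r) ⟩
    (ℤ.+ n) ℤ.^ p ℤ.+ (ℤ.+ n) ℤ.^ q ℤ.+ (ℤ.+ n) ℤ.^ r ℤ.+ ℤ.+ 1 ∎
  where open ≡-Reasoning

a≡P[nˡ]*[dᵏ]³-P[nᵏ]*[dˡ]³ : ∀ k ℓ n d →
  a k ℓ n d ≡ ℤ.+ (P (n ^ ℓ) * cube (d ^ k)) ℤ.- ℤ.+ (P (n ^ k) * cube (d ^ ℓ))
a≡P[nˡ]*[dᵏ]³-P[nᵏ]*[dˡ]³ k ℓ n d = sym (cong₂ ℤ._-_ (cast ℓ k) (cast k ℓ))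
  where
    cast : ∀ i j → ℤ.+ (P (n ^ i) * cube (d ^ j))
         ≡ ((ℤ.+ n) ℤ.^ (3 * i) ℤ.+ (ℤ.+ n) ℤ.^ (2 * i) ℤ.+ (ℤ.+ n) ℤ.^ i ℤ.+ ℤ.+ 1) ℤ.* (ℤ.+ d) ℤ.^ (3 * j)
    cast i j = begin
        ℤ.+ (P (n ^ i) * cube (d ^ j))
      ≡⟨ cong₂ (λ u v → ℤ.+ (u * v)) (n^[3*i]+n^[2*i]+n^i+1≡P[n^i] n i) (n^[3*i]≡[n^i]³ d j) ⟨
        ℤ.+ ((n ^ (3 * i) + n ^ (2 * i) + n ^ i + 1) * d ^ (3 * j))
      ≡⟨ ℤₚ.pos-* (n ^ (3 * i) + n ^ (2 * i) + n ^ i + 1) (d ^ (3 * j)) ⟩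
        ℤ.+ (n ^ (3 * i) + n ^ (2 * i) + n ^ i + 1) ℤ.* ℤ.+ (d ^ (3 * j))
      ≡⟨ cong₂ ℤ._*_ (pos-n^p+n^q+n^r+1 n (3 * i) (2 * i) i) (pos-^ d (3 * j)) ⟩
        ((ℤ.+ n) ℤ.^ (3 * i) ℤ.+ (ℤ.+ n) ℤ.^ (2 * i) ℤ.+ (ℤ.+ n) ℤ.^ i ℤ.+ ℤ.+ 1) ℤ.* (ℤ.+ d) ℤ.^ (3 * j) ∎
      where open ≡-Reasoning

i<j⇒i-j<0 : ∀ {i j} → i ℤ.< j → i ℤ.- j ℤ.< ℤ.0ℤ
i<j⇒i-j<0 {i} {j} i<j = subst (i ℤ.- j ℤ.<_) (ℤₚ.+-inverseʳ j) (ℤₚ.+-monoˡ-< (ℤ.- j) i<j)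

a[n,n]<0 : ∀ k ℓ n → 2 ≤ n → k < ℓ → a k ℓ n n ℤ.< ℤ.0ℤ
a[n,n]<0 k ℓ n 2≤n k<ℓ = subst (ℤ._< ℤ.0ℤ) (sym (a≡P[nˡ]*[dᵏ]³-P[nᵏ]*[dˡ]³ k ℓ n n))
  (i<j⇒i-j<0 (ℤ.+<+ (x<y⇒P[y]*x³<P[x]*y³ (^-monoʳ-< n 2≤n k<ℓ))))

0≤a[n,d] : ∀ k ℓ n d → 1 ≤ n → 2 * d ≤ n → k < ℓ → ℤ.0ℤ ℤ.≤ a k ℓ n d
0≤a[n,d] k ℓ n d 1≤n 2d≤n k<ℓ = subst (ℤ.0ℤ ℤ.≤_) (sym (a≡P[nˡ]*[dᵏ]³-P[nᵏ]*[dˡ]³ k ℓ n d))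
  (ℤₚ.i≤j⇒0≤j-i (ℤ.+≤+ (P[nᵏ]*[dˡ]³≤P[nˡ]*[dᵏ]³ 1≤n 2d≤n k<ℓ)))

lemma3p2 : (k ℓ : ℕ) → 0 < k → 0 < ℓ → Odd k → Odd ℓ → k < ℓ →
    (n : ℕ) → 2 ≤ n → (d : ℕ) → 0 < d → d ∣ n →
    ((a k ℓ n d ℤ.< ℤ.0ℤ → d ≡ n) × (d ≡ n → a k ℓ n d ℤ.< ℤ.0ℤ))
lemma3p2 k ℓ _ _ _ _ k<ℓ (suc n) 2≤n d _ d∣n with m≤n⇒m<n∨m≡n (∣⇒≤ d∣n)
... | inj₂ refl = (λ _ → refl) , (λ _ → a[n,n]<0 k ℓ (suc n) 2≤n k<ℓ)
... | inj₁ d<n  =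
  (λ a<0 → contradiction (0≤a[n,d] k ℓ (suc n) d z<s (m∣n∧m<n⇒2*m≤n d∣n d<n) k<ℓ) (ℤₚ.<⇒≱ a<0)) ,
  (λ d≡n → contradiction d≡n (<⇒≢ d<n))
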